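{- For all integers $l\ge k\ge 2$, $r(k,l)=k+l-1$.
   Context: For a graph whose edges are coloured red and blue, a red (resp. blue) $t$-connected matching is a connected component of the spanning subgraph formed by the red (resp. blue) edges whose maximum matching has size at least $t$. For positive integers $k,l$, $r(k,l)$ denotes the smallest integer $n$ such that every red-blue colouring of the edges of $K_{n,n}$ contains a red $k$-connected matching or a blue $l$-connected matching. -}

module Defs where

open import Data.Nat using (ℕ; _<_; _+_; _∸_)
open import Data.Fin using (Fin)
open import Data.Product using (Σ; ∃; _×_; _,_; proj₁; proj₂)
open import Data.Sum using (_⊎_; inj₁; inj₂)
open import Function.Definitions using (Injective)
open import Relation.Binary.PropositionalEquality using (_≡_)
open import Relation.Binary.Construct.Closure.ReflexiveTransitive using (Star)
open import Relation.Nullary using (¬_)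

data Colour : Set where
  red blue : Colour

-- A red/blue colouring of the edges of K_{n,n}: the edge between left
-- vertex i and right vertex j gets colour  c i j.
Colouring : ℕ → Set
Colouring n = Fin n → Fin n → Colour

Vertex : ℕ → Set
Vertex n = Fin n ⊎ Fin n

data Adj {n : ℕ} (c : Colouring n) (col : Colour) : Vertex n → Vertex n → Set where
  lr : ∀ i j → c i j ≡ col → Adj c col (inj₁ i) (inj₂ j)
  rl : ∀ i j → c i j ≡ col → Adj c col (inj₂ j) (inj₁ i)

Connected : ∀ {n} → Colouring n → Colour → Vertex n → Vertex n → Set
Connected c col = Star (Adj c col)

record Matching {n : ℕ} (c : Colouring n) (col : Colour) (t : ℕ) : Set where
  field
    edge      : Fin t → Fin n × Fin n
    coloured  : ∀ e → c (proj₁ (edge e)) (proj₂ (edge e)) ≡ col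
    injLeft   : Injective _≡_ _≡_ (λ e → proj₁ (edge e))
    injRight  : Injective _≡_ _≡_ (λ e → proj₂ (edge e))

-- A col t-connected matching: a connected component of the col-subgraph
-- (the component of vertex v) whose maximum matching has size ≥ t, i.e.
-- which contains a matching of size t; every edge of the matching has its
-- (left) endpoint in the component of v (the right endpoint then also is,
-- since the edge has colour col).
ConnectedMatching : ∀ {n} → Colouring n → Colour → ℕ → Set
ConnectedMatching {n} c col t =
  Σ (Vertex n) λ v → Σ (Matching c col t) λ M →
    ∀ e → Connected c col v (inj₁ (proj₁ (Matching.edge M e)))

Arrows : ℕ → ℕ → ℕ → Set
Arrows n k l = (c : Colouring n) → ConnectedMatching c red k ⊎ ConnectedMatching c blue l

RamseyNumberIs : ℕ → ℕ → ℕ → Set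
RamseyNumberIs k l m = Arrows m k l × (∀ n → n < m → ¬ Arrows n k l)

-- Lower bound: on K_{k+l-2,k+l-2} colour the edges at the first k-1 left vertices red and the
-- others blue; a matching has distinct left endpoints, so no red one has k edges and no blue
-- one has l edges.
--
-- Upper bound: induction on l, passing the diagonal by exchanging the colours. Given a colouring
-- of K_{k+l,k+l} with k ≤ l+1, restrict to K_{k+l-1,k+l-1}; either there is a red k-connected
-- matching, or a blue connected matching M = {L_e R_e} with l edges. Let U = {u_i}, W = {w_j}
-- be k vertices on each side missed by M. A blue edge u_i w_j with a blue edge from u_i to R
-- or from L to w_j extends M. Otherwise every blue u_i w_j forces u_i red to all of R and all
-- of L red to w_j. If some w_j is red to all of U, pair each u_i with w_i when that edge is red
-- and with a vertex of R otherwise; else L is red to all of W and a red k-matching around one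
-- vertex of W exists, unless k = l+1 and U × W is entirely blue, a blue (l+1)-matching.

module Submission where

open import Defs
open import Data.Nat using (ℕ; _≤_; _+_; _∸_; zero; suc; _<_; _≤?_; s≤s)
open import Data.Nat.Properties
  using (≤-refl; ≤-trans; ≤-reflexive; ≤-pred; n≤1+n; m≤n+m; +-monoʳ-≤; +-comm; +-suc; 1+n≰n; ≰⇒>; m≤n⇒∃[o]m+o≡n)
open import Data.Fin using (Fin; zero; suc; inject≤; punchIn; punchOut; splitAt; _↑ˡ_; _↑ʳ_)
open import Data.Fin.Properties
  using (inject≤-injective; punchIn-injective; punchInᵢ≢i; punchOut-injective; punchIn-punchOut;
         suc-injective; splitAt⁻¹-↑ˡ; splitAt⁻¹-↑ʳ; injective⇒≤; any?; all?; ¬∀⟶∃¬)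
open import Data.Vec.Functional using ([]; _∷_)
open import Data.Product using (∃; _×_; _,_; proj₁; proj₂; <_,_>)
open import Data.Sum as Sum using (_⊎_; inj₁; inj₂; [_,_]′)
open import Data.Empty using (⊥-elim)
open import Function using (_∘_; id; const)
open import Function.Definitions using (Injective)
import Function.Construct.Composition as Composition
open import Relation.Binary.PropositionalEquality using (_≡_; _≢_; refl; sym; trans; cong; subst)
open import Relation.Binary.Construct.Closure.ReflexiveTransitive using (ε; _◅_; _◅◅_; gmap)
open import Relation.Nullary using (¬_; Dec; yes; no)
open import Relation.Nullary.Decidable using (_×-dec_; _⊎-dec_)

_≟ᶜ_ : (x y : Colour) → Dec (x ≡ y)
red  ≟ᶜ red  = yes refl
red  ≟ᶜ blue = no λ ()
blue ≟ᶜ red  = no λ ()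
blue ≟ᶜ blue = yes refl

≢red⇒≡blue : ∀ {x} → x ≢ red → x ≡ blue
≢red⇒≡blue {red}  x≢red = ⊥-elim (x≢red refl)
≢red⇒≡blue {blue} _     = refl

≢blue⇒≡red : ∀ {x} → x ≢ blue → x ≡ red
≢blue⇒≡red {red}  _      = refl
≢blue⇒≡red {blue} x≢blue = ⊥-elim (x≢blue refl)

opposite : Colour → Colour
opposite red  = blue
opposite blue = red

opposite-≡ : ∀ {x y} → opposite x ≡ y → x ≡ opposite y
opposite-≡ {red}  refl = refl
opposite-≡ {blue} refl = refl

∘-injective : ∀ {A B C : Set} {f : A → B} {g : B → C} →
  Injective _≡_ _≡_ g → Injective _≡_ _≡_ f → Injective _≡_ _≡_ (g ∘ f)
∘-injective g-inj f-inj = Composition.injective _≡_ _≡_ _≡_ f-inj g-inj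

∷-injective : ∀ {A : Set} {n} {x : A} {f : Fin n → A} →
  Injective _≡_ _≡_ f → (∀ e → x ≢ f e) → Injective _≡_ _≡_ (x ∷ f)
∷-injective f-inj x∉f {zero}  {zero}  _ = refl
∷-injective f-inj x∉f {zero}  {suc e} p = ⊥-elim (x∉f e p)
∷-injective f-inj x∉f {suc d} {zero}  p = ⊥-elim (x∉f d (sym p))
∷-injective f-inj x∉f {suc d} {suc e} p = cong suc (f-inj p)

inject≤-injective′ : ∀ {m n} (m≤n : m ≤ n) → Injective _≡_ _≡_ (λ (i : Fin m) → inject≤ i m≤n)
inject≤-injective′ m≤n {i} {j} = inject≤-injective m≤n m≤n i j

record InjectionAvoiding {m n} (r : ℕ) (f : Fin m → Fin n) : Set where
  field
    fun       : Fin r → Fin n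
    injective : Injective _≡_ _≡_ fun
    avoids    : ∀ x e → fun x ≢ f e

injection-avoiding : ∀ {m n} r (f : Fin m → Fin n) → Injective _≡_ _≡_ f → m + r ≤ n →
  InjectionAvoiding r f
injection-avoiding {zero} r f _ r≤n = record
  { fun = λ x → inject≤ x r≤n ; injective = inject≤-injective′ r≤n ; avoids = λ _ () }
injection-avoiding {suc m} {suc n} r f f-inj (s≤s m+r≤n) = record
  { fun = g ; injective = g-inj ; avoids = g∉f }
  where
  f₀≢f : ∀ e → f zero ≢ f (suc e)
  f₀≢f e p with f-inj p
  ... | ()

  f′ : Fin m → Fin n
  f′ e = punchOut (f₀≢f e)

  f′-inj : Injective _≡_ _≡_ f′
  f′-inj p = suc-injective (f-inj (punchOut-injective (f₀≢f _) (f₀≢f _) p))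

  open InjectionAvoiding (injection-avoiding r f′ f′-inj m+r≤n)
    renaming (fun to g′; injective to g′-inj; avoids to g′∉f′)

  g : Fin r → Fin (suc n)
  g x = punchIn (f zero) (g′ x)

  g-inj : Injective _≡_ _≡_ g
  g-inj p = g′-inj (punchIn-injective (f zero) _ _ p)

  g∉f : ∀ x e → g x ≢ f e
  g∉f x zero    p = punchInᵢ≢i (f zero) (g′ x) p
  g∉f x (suc e) p = g′∉f′ x e
    (punchIn-injective (f zero) _ _ (trans p (sym (punchIn-punchOut (f₀≢f e)))))

injective-within-image⇒≤ : ∀ {B : Set} {t m} {f : Fin t → B} (g : Fin m → B) →
  Injective _≡_ _≡_ f → (∀ e → ∃ λ x → g x ≡ f e) → t ≤ m
injective-within-image⇒≤ g f-inj preimage = injective⇒≤ {f = proj₁ ∘ preimage} λ {d} {e} p →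
  f-inj (trans (sym (proj₂ (preimage d))) (trans (cong g p) (proj₂ (preimage e))))

left right : ∀ {n c col t} → Matching {n} c col t → Fin t → Fin n
left  M = proj₁ ∘ Matching.edge M
right M = proj₂ ∘ Matching.edge M

matching : ∀ {n} {c : Colouring n} {col t} (f g : Fin t → Fin n) →
  Injective _≡_ _≡_ f → Injective _≡_ _≡_ g → (∀ e → c (f e) (g e) ≡ col) → Matching c col t
matching f g f-inj g-inj coloured = record
  { edge = < f , g > ; coloured = coloured ; injLeft = f-inj ; injRight = g-inj }

module _ {n} {c : Colouring n} {col : Colour} {t : ℕ} where

  hub-connectedMatching : (M : Matching c col t) (z : Fin n) →
    (∀ e → c (left M e) z ≡ col) → ConnectedMatching c col t
  hub-connectedMatching M z to-z = inj₂ z , M , λ e → rl (left M e) z (to-z e) ◅ ε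

  extend-connectedMatching : ∀ {v} (M : Matching c col t) →
    (∀ e → Connected c col v (inj₁ (left M e))) →
    ∀ {i j} → c i j ≡ col → (∀ e → i ≢ left M e) → (∀ e → j ≢ right M e) →
    Connected c col v (inj₁ i) → ConnectedMatching c col (suc t)
  extend-connectedMatching {v} M conn {i} {j} cij i∉M j∉M v⇝i = v , M′ , conn′
    where
    coloured′ : ∀ e → c ((i ∷ left M) e) ((j ∷ right M) e) ≡ col
    coloured′ zero    = cij
    coloured′ (suc e) = Matching.coloured M e

    M′ : Matching c col (suc t)
    M′ = matching (i ∷ left M) (j ∷ right M)
      (∷-injective (Matching.injLeft M) i∉M) (∷-injective (Matching.injRight M) j∉M) coloured′

    conn′ : ∀ e → Connected c col v (inj₁ (left M′ e))
    conn′ zero    = v⇝i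
    conn′ (suc e) = conn e

edge-connectedMatching : ∀ {n} {c : Colouring n} {col} i j → c i j ≡ col → ConnectedMatching c col 1
edge-connectedMatching i j cij =
  hub-connectedMatching (matching (i ∷ []) (j ∷ []) 1-injective 1-injective λ { zero → cij }) j
    λ { zero → cij }
  where
  1-injective : ∀ {A : Set} {f : Fin 1 → A} → Injective _≡_ _≡_ f
  1-injective {x = zero} {zero} _ = refl

map-connectedMatching : ∀ {m n} {c : Colouring m} {d : Colouring n} {col col′ t}
  {φ : Fin m → Fin n} → Injective _≡_ _≡_ φ →
  (∀ {i j} → c i j ≡ col → d (φ i) (φ j) ≡ col′) →
  ConnectedMatching c col t → ConnectedMatching d col′ t
map-connectedMatching {m} {n} {c} {d} {col} {col′} {t} {φ} φ-inj preserves (v , M , conn) =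
  φ² v , M′ , λ e → gmap φ² adj (conn e)
  where
  φ² : Vertex m → Vertex n
  φ² = Sum.map φ φ

  adj : ∀ {x y} → Adj c col x y → Adj d col′ (φ² x) (φ² y)
  adj (lr i j p) = lr (φ i) (φ j) (preserves p)
  adj (rl i j p) = rl (φ i) (φ j) (preserves p)

  M′ : Matching d col′ t
  M′ = matching (φ ∘ left M) (φ ∘ right M)
    (∘-injective φ-inj (Matching.injLeft M)) (∘-injective φ-inj (Matching.injRight M))
    (preserves ∘ Matching.coloured M)

Arrows-mono : ∀ {m n k l} → m ≤ n → Arrows m k l → Arrows n k l
Arrows-mono {m} m≤n arrows c = Sum.map lift lift (arrows c′)
  where
  c′ : Colouring m
  c′ = λ i j → c (inject≤ i m≤n) (inject≤ j m≤n)

  lift : ∀ {col t} → ConnectedMatching c′ col t → ConnectedMatching c col t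
  lift = map-connectedMatching (inject≤-injective′ m≤n) id

Arrows-sym : ∀ {n k l} → Arrows n k l → Arrows n l k
Arrows-sym {n} arrows c = Sum.swap (Sum.map unswap unswap (arrows c′))
  where
  c′ : Colouring n
  c′ = λ i j → opposite (c i j)

  unswap : ∀ {col t} → ConnectedMatching c′ col t → ConnectedMatching c (opposite col) t
  unswap = map-connectedMatching id opposite-≡

arrows-1-1-1 : Arrows 1 1 1
arrows-1-1-1 c with c zero zero in c₀₀
... | red  = inj₁ (edge-connectedMatching zero zero c₀₀)
... | blue = inj₂ (edge-connectedMatching zero zero c₀₀)

module FromBlueMatching {a l : ℕ} (a≤l : a ≤ l) (c : Colouring (a + suc l))
  {v : Vertex (a + suc l)} (M : Matching c blue l)
  (conn : ∀ e → Connected c blue v (inj₁ (left M e))) where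

  N : ℕ
  N = a + suc l

  L R : Fin l → Fin N
  L = left M
  R = right M

  shrink : Fin a → Fin l
  shrink x = inject≤ x a≤l

  room : l + suc a ≤ N
  room = ≤-reflexive (trans (+-comm l (suc a)) (sym (+-suc a l)))

  open InjectionAvoiding (injection-avoiding (suc a) L (Matching.injLeft M) room)
    renaming (fun to u; injective to u-inj; avoids to u∉L)
  open InjectionAvoiding (injection-avoiding (suc a) R (Matching.injRight M) room)
    renaming (fun to w; injective to w-inj; avoids to w∉R)

  Extendable : Fin (suc a) → Fin (suc a) → Set
  Extendable i j = c (u i) (w j) ≡ blue ×
    ((∃ λ e → c (u i) (R e) ≡ blue) ⊎ (∃ λ e → c (L e) (w j) ≡ blue))

  extendable? : ∀ i j → Dec (Extendable i j)
  extendable? i j = (c (u i) (w j) ≟ᶜ blue) ×-dec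
    (any? (λ e → c (u i) (R e) ≟ᶜ blue) ⊎-dec any? (λ e → c (L e) (w j) ≟ᶜ blue))

  extend : ∀ {i j} → Extendable i j → ConnectedMatching c blue (suc l)
  extend {i} {j} (uw-blue , reach) =
    extend-connectedMatching M conn uw-blue (u∉L i) (w∉R j) (v⇝u reach)
    where
    v⇝u : (∃ λ e → c (u i) (R e) ≡ blue) ⊎ (∃ λ e → c (L e) (w j) ≡ blue) →
          Connected c blue v (inj₁ (u i))
    v⇝u (inj₁ (e , uR-blue)) =
      conn e ◅◅ lr (L e) (R e) (Matching.coloured M e) ◅ rl (u i) (R e) uR-blue ◅ ε
    v⇝u (inj₂ (e , Lw-blue)) =
      conn e ◅◅ lr (L e) (w j) Lw-blue ◅ rl (u i) (w j) uw-blue ◅ ε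

  red-cross : (∀ e j → c (L e) (w j) ≡ red) → ∀ {i j} → c (u i) (w j) ≡ red →
    ConnectedMatching c red (suc a)
  red-cross Lw-red {i} {j} uw-red = hub-connectedMatching M′ (w j) to-w
    where
    M′ : Matching c red (suc a)
    M′ = matching (u i ∷ L ∘ shrink) (w j ∷ w ∘ punchIn j)
      (∷-injective (∘-injective (Matching.injLeft M) (inject≤-injective′ a≤l)) (λ x → u∉L i (shrink x)))
      (∷-injective (∘-injective w-inj (punchIn-injective j _ _)) (λ x p → punchInᵢ≢i j x (sym (w-inj p))))
      λ { zero → uw-red ; (suc x) → Lw-red (shrink x) (punchIn j x) }

    to-w : ∀ e → c (left M′ e) (w j) ≡ red
    to-w zero    = uw-red
    to-w (suc x) = Lw-red (shrink x) j

  red-block : suc a ≤ l → (∀ e j → c (L e) (w j) ≡ red) → ConnectedMatching c red (suc a)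
  red-block k≤l Lw-red = hub-connectedMatching M′ (w zero) λ j → Lw-red _ zero
    where
    M′ : Matching c red (suc a)
    M′ = matching (λ j → L (inject≤ j k≤l)) w
      (∘-injective (Matching.injLeft M) (inject≤-injective′ k≤l)) w-inj λ j → Lw-red _ j

  blue-diagonal : suc l ≤ suc a → (∀ i j → c (u i) (w j) ≡ blue) → ConnectedMatching c blue (suc l)
  blue-diagonal l<k uw-blue = hub-connectedMatching M′ (w zero) λ x → uw-blue _ zero
    where
    M′ : Matching c blue (suc l)
    M′ = matching (λ x → u (inject≤ x l<k)) (λ x → w (inject≤ x l<k))
      (∘-injective u-inj (inject≤-injective′ l<k)) (∘-injective w-inj (inject≤-injective′ l<k))
      λ x → uw-blue _ _

  red-or-blue-when-Lw-red : (∀ e j → c (L e) (w j) ≡ red) →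
    ConnectedMatching c red (suc a) ⊎ ConnectedMatching c blue (suc l)
  red-or-blue-when-Lw-red Lw-red with any? (λ i → any? (λ j → c (u i) (w j) ≟ᶜ red))
  ... | yes (_ , _ , uw-red) = inj₁ (red-cross Lw-red uw-red)
  ... | no ¬uw-red with suc a ≤? l
  ...   | yes k≤l = inj₁ (red-block k≤l Lw-red)
  ...   | no  k≰l = inj₂ (blue-diagonal (≰⇒> k≰l) uw-blue)
    where
    uw-blue : ∀ i j → c (u i) (w j) ≡ blue
    uw-blue i j = ≢red⇒≡blue λ uw-red → ¬uw-red (i , j , uw-red)

  module NonExtendable (stuck : ∀ i j → ¬ Extendable i j) where

    uR-red : ∀ i j → c (u i) (w j) ≡ blue → ∀ e → c (u i) (R e) ≡ red
    uR-red i j uw-blue e = ≢blue⇒≡red λ uR-blue → stuck i j (uw-blue , inj₁ (e , uR-blue))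

    Lw-red : ∀ i j → c (u i) (w j) ≡ blue → ∀ e → c (L e) (w j) ≡ red
    Lw-red i j uw-blue e = ≢blue⇒≡red λ Lw-blue → stuck i j (uw-blue , inj₂ (e , Lw-blue))

    red-column : ∀ j₀ → (∀ i → c (u i) (w j₀) ≡ red) → ConnectedMatching c red (suc a)
    red-column j₀ column = hub-connectedMatching M′ (w j₀) column
      where
      j₀≢ : ∀ {i} → c (u i) (w i) ≢ red → j₀ ≢ i
      j₀≢ uw≢red refl = uw≢red (column j₀)

      -- A blue diagonal edge u_i w_i forces i ≢ j₀, so at most a rows need a vertex of R.
      partner : ∀ i → Dec (c (u i) (w i) ≡ red) → Fin N
      partner i (yes _)      = w i
      partner i (no uw≢red) = R (shrink (punchOut (j₀≢ uw≢red)))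

      partner-red : ∀ i d → c (u i) (partner i d) ≡ red
      partner-red i (yes uw-red) = uw-red
      partner-red i (no uw≢red) = uR-red i i (≢red⇒≡blue uw≢red) _

      partner-injective : ∀ i i′ d d′ → partner i d ≡ partner i′ d′ → i ≡ i′
      partner-injective i i′ (yes _) (yes _) p = w-inj p
      partner-injective i i′ (yes _) (no _)  p = ⊥-elim (w∉R i _ p)
      partner-injective i i′ (no _)  (yes _) p = ⊥-elim (w∉R i′ _ (sym p))
      partner-injective i i′ (no ¬r) (no ¬r′) p =
        punchOut-injective (j₀≢ ¬r) (j₀≢ ¬r′) (inject≤-injective′ a≤l (Matching.injRight M p))

      M′ : Matching c red (suc a)
      M′ = matching u (λ i → partner i (diagonal? i)) u-inj
        (λ {i} {i′} → partner-injective i i′ (diagonal? i) (diagonal? i′))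
        (λ i → partner-red i (diagonal? i))
        where
        diagonal? : ∀ i → Dec (c (u i) (w i) ≡ red)
        diagonal? i = c (u i) (w i) ≟ᶜ red

    Lw-red-everywhere : ¬ (∃ λ j → ∀ i → c (u i) (w j) ≡ red) → ∀ e j → c (L e) (w j) ≡ red
    Lw-red-everywhere ¬column e j
      with ¬∀⟶∃¬ _ _ (λ i → c (u i) (w j) ≟ᶜ red) (λ column → ¬column (j , column))
    ... | i , uw≢red = Lw-red i j (≢red⇒≡blue uw≢red) e

    red-or-blue : ConnectedMatching c red (suc a) ⊎ ConnectedMatching c blue (suc l)
    red-or-blue with any? (λ j → all? (λ i → c (u i) (w j) ≟ᶜ red))
    ... | yes (j₀ , column) = inj₁ (red-column j₀ column)
    ... | no ¬column        = red-or-blue-when-Lw-red (Lw-red-everywhere ¬column)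

  red-or-blue : ConnectedMatching c red (suc a) ⊎ ConnectedMatching c blue (suc l)
  red-or-blue with any? (λ i → any? (extendable? i))
  ... | yes (_ , _ , extendable) = inj₂ (extend extendable)
  ... | no ¬extendable           = NonExtendable.red-or-blue λ i j x → ¬extendable (i , j , x)

Arrows-step : ∀ {a l} → a ≤ l → Arrows (a + l) (suc a) l → Arrows (a + suc l) (suc a) (suc l)
Arrows-step {a} {l} a≤l arrows c with Arrows-mono (+-monoʳ-≤ a (n≤1+n l)) arrows c
... | inj₁ red-matching   = inj₁ red-matching
... | inj₂ (_ , M , conn) = FromBlueMatching.red-or-blue a≤l c M conn

arrows-above-diagonal : ∀ a d → Arrows (a + (d + suc a)) (suc a) (d + suc a)
arrows-above-diagonal zero    zero    = arrows-1-1-1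
-- k = l = a+2 is one step up from k = a+2, l = a+1, which is k = a+1, l = a+2 with the colours
-- exchanged.
arrows-above-diagonal (suc a) zero    = Arrows-step ≤-refl (subst (λ n → Arrows n (suc (suc a)) (suc a))
  (+-suc a (suc a)) (Arrows-sym (arrows-above-diagonal a 1)))
arrows-above-diagonal a       (suc d) =
  Arrows-step (≤-trans (n≤1+n a) (m≤n+m (suc a) d)) (arrows-above-diagonal a d)

split-colouring : ∀ a b → Colouring (a + b)
split-colouring a b i _ = [ const red , const blue ]′ (splitAt a i)

red-row : ∀ {a b} (i : Fin (a + b)) → [ const red , const blue ]′ (splitAt a i) ≡ red → ∃ λ x → x ↑ˡ b ≡ i
red-row {a} i p with splitAt a i in split
red-row i p  | inj₁ x = x , splitAt⁻¹-↑ˡ split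
red-row i () | inj₂ _

blue-row : ∀ {a b} (i : Fin (a + b)) → [ const red , const blue ]′ (splitAt a i) ≡ blue → ∃ λ y → a ↑ʳ y ≡ i
blue-row {a} i p with splitAt a i in split
blue-row i () | inj₁ _
blue-row i p  | inj₂ y = y , splitAt⁻¹-↑ʳ split

split-colouring-refutes : ∀ a b → ¬ Arrows (a + b) (suc a) (suc b)
split-colouring-refutes a b arrows with arrows (split-colouring a b)
... | inj₁ (_ , M , _) = 1+n≰n (injective-within-image⇒≤ (_↑ˡ b) (Matching.injLeft M)
                                 λ e → red-row (left M e) (Matching.coloured M e))
... | inj₂ (_ , M , _) = 1+n≰n (injective-within-image⇒≤ (a ↑ʳ_) (Matching.injLeft M)
                                 λ e → blue-row (left M e) (Matching.coloured M e))

theorem3p1 : ∀ (k l : ℕ) → 2 ≤ k → k ≤ l → RamseyNumberIs k l (k + l ∸ 1)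
theorem3p1 (suc a) (suc b) _ k≤l = arrows , minimal
  where
  arrows : Arrows (a + suc b) (suc a) (suc b)
  arrows with m≤n⇒∃[o]m+o≡n k≤l
  ... | d , k+d≡l = subst (λ l → Arrows (a + l) (suc a) l) (trans (+-comm d (suc a)) k+d≡l)
                      (arrows-above-diagonal a d)

  minimal : ∀ n → n < a + suc b → ¬ Arrows n (suc a) (suc b)
  minimal n n<k+l-1 =
    split-colouring-refutes a b ∘ Arrows-mono (≤-pred (subst (n <_) (+-suc a b) n<k+l-1))
theorem3p1 zero    _    () _
theorem3p1 (suc a) zero _  ()
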